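{- Let $G$ be a graph. Then the following statements are equivalent: (1) $G$ is neighborhood perfect; (2) for all $k \in \mathbb{N}_0$ and all induced subgraphs $H$ of $G$, $H \in \varOmega_k$ if and only if $H\in \varUpsilon_k$.
   Context: All graphs are finite and simple. A graph is perfect if $\omega(H)=\chi(H)$ for each of its induced subgraphs $H$; a graph is neighborhood perfect if for every vertex $v$ the subgraph induced by the neighborhood $N(v)$ is perfect. $\Delta,\omega,\chi$ denote maximum degree, clique number, chromatic number. For $k\in\mathbb{N}_0$: $\varOmega_k$ is the class of graphs $G$ such that every induced subgraph $H$ of $G$ (including $G$) satisfies $\Delta(H)\le\omega(H)+k-1$; $\varUpsilon_k$ is the class of graphs $G$ such that every induced subgraph $H$ of $G$ (including $G$) satisfies $\Delta(H)\le\chi(H)+k-1$. -}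

module Defs where

open import Data.Nat using (ℕ; zero; suc; _+_; _≤_)
open import Data.Fin using (Fin)
open import Data.Bool using (Bool; true; false; if_then_else_)
open import Data.List using (List; map; allFin)
open import Data.Nat.ListAction using (sum)
open import Data.Product using (Σ; ∃; _×_; _,_)
open import Data.Sum using (_⊎_)
open import Relation.Binary.PropositionalEquality using (_≡_; _≢_)
open import Function.Definitions using (Injective)

record Graph (n : ℕ) : Set where
  field
    adj    : Fin n → Fin n → Bool
    sym    : ∀ i j → adj i j ≡ adj j i
    irrefl : ∀ i → adj i i ≡ false
open Graph public

-- The subgraph of G induced by the image of an injective map f : Fin m → Fin n.
-- Every induced subgraph of G (up to isomorphism) arises this way.
induce : ∀ {n m} (G : Graph n) (f : Fin m → Fin n) → Injective _≡_ _≡_ f → Graph m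
induce G f _ = record
  { adj    = λ i j → adj G (f i) (f j)
  ; sym    = λ i j → sym G (f i) (f j)
  ; irrefl = λ i → irrefl G (f i)
  }

deg : ∀ {n} → Graph n → Fin n → ℕ
deg {n} G v = sum (map (λ u → if adj G v u then 1 else 0) (allFin n))

-- d is the maximum degree Δ(G) (Δ of the empty graph is 0)
IsMaxDegree : ∀ {n} → Graph n → ℕ → Set
IsMaxDegree G d = (∀ v → deg G v ≤ d) × (d ≡ 0 ⊎ ∃ λ v → deg G v ≡ d)

HasClique : ∀ {n} → Graph n → ℕ → Set
HasClique {n} G s =
  Σ (Fin s → Fin n) λ f → Injective _≡_ _≡_ f × (∀ i j → i ≢ j → adj G (f i) (f j) ≡ true)

IsCliqueNumber : ∀ {n} → Graph n → ℕ → Set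
IsCliqueNumber G w = HasClique G w × (∀ s → HasClique G s → s ≤ w)

Colorable : ∀ {n} → Graph n → ℕ → Set
Colorable {n} G k =
  Σ (Fin n → Fin k) λ c → ∀ i j → adj G i j ≡ true → c i ≢ c j

IsChromaticNumber : ∀ {n} → Graph n → ℕ → Set
IsChromaticNumber G k = Colorable G k × (∀ k' → Colorable G k' → k ≤ k')

Perfect : ∀ {n} → Graph n → Set
Perfect {n} G =
  ∀ m (f : Fin m → Fin n) (inj : Injective _≡_ _≡_ f) (w c : ℕ) →
  IsCliqueNumber (induce G f inj) w → IsChromaticNumber (induce G f inj) c → w ≡ c

-- G is neighbourhood perfect: for every vertex v, the subgraph induced by N(v)
-- is perfect.  N(v) is given by any injective enumeration f of exactly the
-- neighbours of v.
NeighborhoodPerfect : ∀ {n} → Graph n → Set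
NeighborhoodPerfect {n} G =
  ∀ (v : Fin n) m (f : Fin m → Fin n) (inj : Injective _≡_ _≡_ f) →
  (∀ i → adj G v (f i) ≡ true) →
  (∀ u → adj G v u ≡ true → ∃ λ i → f i ≡ u) →
  Perfect (induce G f inj)

-- Ω_k: every (nonempty) induced subgraph H satisfies Δ(H) ≤ ω(H) + k - 1,
-- written in ℕ as Δ(H) + 1 ≤ ω(H) + k.
InOmega : ℕ → ∀ {n} → Graph n → Set
InOmega k {n} G =
  ∀ m (f : Fin (suc m) → Fin n) (inj : Injective _≡_ _≡_ f) (d w : ℕ) →
  IsMaxDegree (induce G f inj) d → IsCliqueNumber (induce G f inj) w → d + 1 ≤ w + k

InUpsilon : ℕ → ∀ {n} → Graph n → Set
InUpsilon k {n} G =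
  ∀ m (f : Fin (suc m) → Fin n) (inj : Injective _≡_ _≡_ f) (d c : ℕ) →
  IsMaxDegree (induce G f inj) d → IsChromaticNumber (induce G f inj) c → d + 1 ≤ c + k

-- Both directions use apex graphs: graphs on
-- Fin (suc q) whose vertex zero is adjacent to all others; for them Δ = q,
-- ω = ω(rest) + 1 and χ = χ(rest) + 1.
--
-- (⇒) Ω_k ⊆ Υ_k always, since ω ≤ χ.  If the neighbourhoods of J are perfect
--     and J ∈ Υ_k, the apex graph on v ∪ N(v), for v of maximum degree d, has
--     Δ = d and χ = ω(N(v)) + 1 ≤ ω(J), so d + 1 ≤ ω(J) + k; neighbourhood
--     perfection is hereditary, so this holds in every induced subgraph.
-- (⇐) Every graph G on n vertices lies in Υ_{n ∸ χ(G)}, as deleting t vertices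
--     lowers χ by at most t.  If B ⊆ N(v) had ω(B) < χ(B), the apex graph on
--     v ∪ B would lie in Υ_{|B| ∸ χ(B)} but not in Ω_{|B| ∸ χ(B)}.
module Submission where

open import Defs
open import Data.Nat using (ℕ; zero; suc; _+_; _∸_; _≤_; _<_; z≤n; s≤s; s≤s⁻¹; _≤?_)
open import Data.Nat.Properties
  using (≤-reflexive; ≤-trans; n≤1+n; ≤-antisym; ≤∧≢⇒<; ≰⇒>; 1+n≰n; m≤m+n; m≤n+m;
         +-comm; +-assoc; +-suc; +-identityʳ; +-monoˡ-≤; +-mono-≤; +-cancelʳ-≤; m+[n∸m]≡n;
         m≤n⇒∃[o]m+o≡n; module ≤-Reasoning)
open import Data.Fin using (Fin; zero; suc; punchIn; punchOut; inject≤; _≟_)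
open import Data.Fin.Properties
  using (¬Fin0; any?; all?; ¬∀⟶∃¬; suc-injective; injective⇒≤; inject≤-injective;
         punchOut-injective; punchIn-injective; punchInᵢ≢i; punchIn-punchOut)
open import Data.Vec.Functional using (_∷_)
open import Data.Bool using (Bool; true; false; if_then_else_)
import Data.Bool.Properties as Bool
open import Data.List using (map; tabulate)
open import Data.Nat.ListAction using (sum)
open import Data.Product using (∃; _×_; _,_; proj₁; proj₂)
open import Data.Sum using (_⊎_; inj₁; inj₂)
open import Data.Empty using (⊥-elim)
open import Function using (_∘_)
open import Relation.Nullary using (Dec; yes; no; ¬_)
open import Relation.Nullary.Decidable using (map′; _→-dec_; _×-dec_; ¬?)
open import Relation.Binary.PropositionalEquality
  using (_≡_; _≢_; refl; trans; cong; cong₂; subst) renaming (sym to ≡-sym)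
open import Function.Definitions using (Injective)
open import Function.Bundles using (_⇔_; mk⇔; Equivalence)

private
  variable
    n m q s k c w : ℕ

false≢true : false ≢ true
false≢true ()

count : (Fin n → Bool) → ℕ
count {zero}  b = 0
count {suc n} b = (if b zero then 1 else 0) + count (b ∘ suc)

sum-indicators : ∀ {A : Set} (b : A → Bool) (h : Fin n → A) →
  sum (map (λ u → if b u then 1 else 0) (tabulate h)) ≡ count (b ∘ h)
sum-indicators {zero}  b h = refl
sum-indicators {suc n} b h = cong ((if b (h zero) then 1 else 0) +_) (sum-indicators b (h ∘ suc))

deg≡count : (G : Graph n) (v : Fin n) → deg G v ≡ count (adj G v)
deg≡count G v = sum-indicators (adj G v) (λ u → u)

indicator≤1 : ∀ x → (if x then 1 else 0) ≤ 1
indicator≤1 true  = s≤s z≤n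
indicator≤1 false = z≤n

count≤ : (b : Fin n → Bool) → count b ≤ n
count≤ {zero}  b = z≤n
count≤ {suc n} b = +-mono-≤ (indicator≤1 (b zero)) (count≤ (b ∘ suc))

count≤-missing : (b : Fin (suc n) → Bool) (v : Fin (suc n)) → b v ≡ false → count b ≤ n
count≤-missing b zero bv≡false rewrite bv≡false = count≤ (b ∘ suc)
count≤-missing {suc n} b (suc v) bv≡false =
  +-mono-≤ (indicator≤1 (b zero)) (count≤-missing (b ∘ suc) v bv≡false)

count-all : (b : Fin n → Bool) → (∀ i → b i ≡ true) → count b ≡ n
count-all {zero}  b all-true = refl
count-all {suc n} b all-true rewrite all-true zero =
  cong suc (count-all (b ∘ suc) (all-true ∘ suc))

-- No vertex is its own neighbour, so degrees are below the order.
deg≤ : (G : Graph (suc q)) (u : Fin (suc q)) → deg G u ≤ q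
deg≤ G u rewrite deg≡count G u = count≤-missing (adj G u) u (irrefl G u)

maxDegree≤ : ∀ {d} {G : Graph (suc q)} → IsMaxDegree G d → d ≤ q
maxDegree≤ (_ , inj₁ refl)          = z≤n
maxDegree≤ {G = G} (_ , inj₂ (u , refl)) = deg≤ G u

∷-injective : ∀ {x} {f : Fin m → Fin n} → Injective _≡_ _≡_ f → (∀ i → f i ≢ x) →
  Injective _≡_ _≡_ (x ∷ f)
∷-injective f-inj x∉ {zero}  {zero}  _  = refl
∷-injective f-inj x∉ {zero}  {suc j} eq = ⊥-elim (x∉ j (≡-sym eq))
∷-injective f-inj x∉ {suc i} {zero}  eq = ⊥-elim (x∉ i eq)
∷-injective f-inj x∉ {suc i} {suc j} eq = cong suc (f-inj eq)

record Enumeration (b : Fin n → Bool) : Set where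
  field
    size      : ℕ
    size≡     : size ≡ count b
    elem      : Fin size → Fin n
    injective : Injective _≡_ _≡_ elem
    sound     : ∀ i → b (elem i) ≡ true
    complete  : ∀ u → b u ≡ true → ∃ λ i → elem i ≡ u

count-head : (b : Fin (suc n) → Bool) {x : Bool} → b zero ≡ x →
  count b ≡ (if x then 1 else 0) + count (b ∘ suc)
count-head b refl = refl

enumerate : (b : Fin n → Bool) → Enumeration b
enumerate {zero} b = record
  { size = 0 ; size≡ = refl ; elem = λ () ; injective = λ {i} → ⊥-elim (¬Fin0 i)
  ; sound = λ () ; complete = λ () }
enumerate {suc n} b with b zero in b0 | enumerate (b ∘ suc)
... | true | tail = record
  { size      = suc size
  ; size≡     = trans (cong suc size≡) (≡-sym (count-head b b0))
  ; elem      = zero ∷ (suc ∘ elem)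
  ; injective = ∷-injective (λ eq → injective (suc-injective eq)) (λ _ ())
  ; sound     = λ { zero → b0 ; (suc i) → sound i }
  ; complete  = λ { zero _ → zero , refl
                  ; (suc u) bu → let (i , eq) = complete u bu in suc i , cong suc eq }
  }
  where open Enumeration tail
... | false | tail = record
  { size      = size
  ; size≡     = trans size≡ (≡-sym (count-head b b0))
  ; elem      = suc ∘ elem
  ; injective = λ eq → injective (suc-injective eq)
  ; sound     = sound
  ; complete  = λ { zero bu → ⊥-elim (false≢true (trans (≡-sym b0) bu))
                  ; (suc u) bu → let (i , eq) = complete u bu in i , cong suc eq }
  }
  where open Enumeration tail

adjacent≢ : (G : Graph n) {v u : Fin n} → adj G v u ≡ true → u ≢ v
adjacent≢ G {v} a refl = false≢true (trans (≡-sym (irrefl G v)) a)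

singleton-clique : (G : Graph (suc q)) → HasClique G 1
singleton-clique G =
  (λ _ → zero) , (λ { {zero} {zero} _ → refl }) , λ { zero zero 0≢0 → ⊥-elim (0≢0 refl) }

IsClique : Graph n → (Fin s → Fin n) → Set
IsClique G K = Injective _≡_ _≡_ K × (∀ i j → i ≢ j → adj G (K i) (K j) ≡ true)

IsProper : Graph n → (Fin n → Fin k) → Set
IsProper G col = ∀ i j → adj G i j ≡ true → col i ≢ col j

-- A colouring is injective on a clique, hence ω ≤ χ.
clique≤colouring : (G : Graph n) → HasClique G s → Colorable G c → s ≤ c
clique≤colouring G (K , K-inj , K-clique) (col , proper) = injective⇒≤ col∘K-inj
  where
  col∘K-inj : Injective _≡_ _≡_ (col ∘ K)
  col∘K-inj {i} {j} eq with i ≟ j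
  ... | yes i≡j = i≡j
  ... | no  i≢j = ⊥-elim (proper (K i) (K j) (K-clique i j i≢j) eq)

identityColouring : (G : Graph n) → Colorable G n
identityColouring G = (λ i → i) , λ { i _ a refl → false≢true (trans (≡-sym (irrefl G i)) a) }

Extensional : ((Fin s → Fin n) → Set) → Set
Extensional P = ∀ {f g} → (∀ i → f i ≡ g i) → P f → P g

∃-map? : ∀ s (P : (Fin s → Fin n) → Set) → Extensional P → (∀ f → Dec (P f)) → Dec (∃ P)
∃-map? zero P ext P? =
  map′ (λ p → _ , p) (λ (f , pf) → ext (λ ()) pf) (P? (λ ()))
∃-map? (suc s) P ext P? =
  map′ (λ (a , f , pf) → a ∷ f , pf)
       (λ (f , pf) → f zero , f ∘ suc , ext (λ { zero → refl ; (suc i) → refl }) pf)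
       (any? λ a → ∃-map? s (P ∘ (a ∷_)) (λ f≗g → ext (λ { zero → refl ; (suc i) → f≗g i }))
                                          (P? ∘ (a ∷_)))

injective? : (f : Fin s → Fin n) → Dec (Injective _≡_ _≡_ f)
injective? f = map′ (λ h {x} {y} → h x y) (λ f-inj x y → f-inj)
  (all? λ x → all? λ y → (f x ≟ f y) →-dec (x ≟ y))

hasClique? : (G : Graph n) (s : ℕ) → Dec (HasClique G s)
hasClique? G s = ∃-map? s (IsClique G) isClique-ext λ K →
  injective? K ×-dec all? λ i → all? λ j → ¬? (i ≟ j) →-dec (adj G (K i) (K j) Bool.≟ true)
  where
  isClique-ext : Extensional (IsClique G)
  isClique-ext {f} {g} f≗g (f-inj , f-clique) =
    (λ {x} {y} eq → f-inj (trans (f≗g x) (trans eq (≡-sym (f≗g y))))) ,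
    λ i j i≢j → trans (cong₂ (adj G) (≡-sym (f≗g i)) (≡-sym (f≗g j))) (f-clique i j i≢j)

colorable? : (G : Graph n) (k : ℕ) → Dec (Colorable G k)
colorable? G k = ∃-map? _ (IsProper G) isProper-ext λ col →
  all? λ i → all? λ j → (adj G i j Bool.≟ true) →-dec ¬? (col i ≟ col j)
  where
  isProper-ext : Extensional (IsProper G)
  isProper-ext f≗g f-proper i j a eq = f-proper i j a (trans (f≗g i) (trans eq (≡-sym (f≗g j))))

greatest : (P : ℕ → Set) → (∀ s → Dec (P s)) → P 0 → ∀ b → (∀ s → P s → s ≤ b) →
  ∃ λ w → P w × (∀ s → P s → s ≤ w)
greatest P P? P0 zero    bounded = 0 , P0 , bounded
greatest P P? P0 (suc b) bounded with P? (suc b)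
... | yes Pb = suc b , Pb , bounded
... | no ¬Pb = greatest P P? P0 b λ s Ps →
  s≤s⁻¹ (≤∧≢⇒< (bounded s Ps) λ { refl → ¬Pb Ps })

least : (P : ℕ → Set) → (∀ s → Dec (P s)) → ∀ b → P b → ∃ λ k → P k × (∀ k′ → P k′ → k ≤ k′)
least P P? b Pb with P? 0
... | yes P0 = 0 , P0 , λ _ _ → z≤n
least P P? zero    Pb | no ¬P0 = ⊥-elim (¬P0 Pb)
least P P? (suc b) Pb | no ¬P0 with least (P ∘ suc) (P? ∘ suc) b Pb
... | k , Pk , minimal =
  suc k , Pk , λ { zero P0 → ⊥-elim (¬P0 P0) ; (suc k′) Pk′ → s≤s (minimal k′ Pk′) }

cliqueNumber : (G : Graph n) → ∃ (IsCliqueNumber G)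
cliqueNumber {n} G = greatest (HasClique G) (hasClique? G) ((λ ()) , (λ {}) , λ ()) n
  λ s (K , K-inj , _) → injective⇒≤ K-inj

chromaticNumber : (G : Graph n) → ∃ (IsChromaticNumber G)
chromaticNumber {n} G = least (Colorable G) (colorable? G) n (identityColouring G)

record _≈ᴳ_ (A B : Graph n) : Set where
  constructor mk≈
  field same-adj : ∀ i j → adj A i j ≡ adj B i j
open _≈ᴳ_

≈ᴳ-sym : {A B : Graph n} → A ≈ᴳ B → B ≈ᴳ A
≈ᴳ-sym A≈B = mk≈ λ i j → ≡-sym (same-adj A≈B i j)

induce-cong : (G : Graph n) {f g : Fin m → Fin n} {f-inj : Injective _≡_ _≡_ f}
  {g-inj : Injective _≡_ _≡_ g} → (∀ i → f i ≡ g i) → induce G f f-inj ≈ᴳ induce G g g-inj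
induce-cong G f≗g = mk≈ λ i j → cong₂ (adj G) (f≗g i) (f≗g j)

induce-≈ : {A B : Graph n} → A ≈ᴳ B → (f : Fin m → Fin n) (f-inj : Injective _≡_ _≡_ f) →
  induce A f f-inj ≈ᴳ induce B f f-inj
induce-≈ A≈B f f-inj = mk≈ λ i j → same-adj A≈B (f i) (f j)

hasClique-≈ : {A B : Graph n} → A ≈ᴳ B → HasClique A s → HasClique B s
hasClique-≈ A≈B (K , K-inj , K-clique) =
  K , K-inj , λ i j i≢j → trans (≡-sym (same-adj A≈B (K i) (K j))) (K-clique i j i≢j)

colorable-≈ : {A B : Graph n} → A ≈ᴳ B → Colorable A k → Colorable B k
colorable-≈ A≈B (col , proper) = col , λ i j a → proper i j (trans (same-adj A≈B i j) a)

cliqueNumber-≈ : {A B : Graph n} → A ≈ᴳ B → IsCliqueNumber A w → IsCliqueNumber B w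
cliqueNumber-≈ A≈B (clique , maximal) =
  hasClique-≈ A≈B clique , λ s K → maximal s (hasClique-≈ (≈ᴳ-sym A≈B) K)

chromaticNumber-≈ : {A B : Graph n} → A ≈ᴳ B → IsChromaticNumber A c → IsChromaticNumber B c
chromaticNumber-≈ A≈B (colouring , minimal) =
  colorable-≈ A≈B colouring , λ k col → minimal k (colorable-≈ (≈ᴳ-sym A≈B) col)

perfect-≈ : {A B : Graph n} → A ≈ᴳ B → Perfect A → Perfect B
perfect-≈ A≈B A-perfect m g g-inj w c cw cχ = A-perfect m g g-inj w c
  (cliqueNumber-≈ B≈A cw) (chromaticNumber-≈ B≈A cχ)
  where B≈A = induce-≈ (≈ᴳ-sym A≈B) g g-inj

hasClique-induce : {G : Graph n} {f : Fin m → Fin n} {f-inj : Injective _≡_ _≡_ f} →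
  HasClique (induce G f f-inj) s → HasClique G s
hasClique-induce {f-inj = f-inj} (K , K-inj , K-clique) = _ , (λ eq → K-inj (f-inj eq)) , K-clique

-- An induced subgraph of induce G f is induced in G by the composite map, so the
-- hereditary notions pass to induced subgraphs.
perfect-induce : (G : Graph n) → Perfect G → (f : Fin m → Fin n) (f-inj : Injective _≡_ _≡_ f) →
  Perfect (induce G f f-inj)
perfect-induce G G-perfect f f-inj m′ g g-inj = G-perfect m′ (f ∘ g) (λ eq → g-inj (f-inj eq))

upsilon-induce : (G : Graph n) → InUpsilon k G → (f : Fin m → Fin n) (f-inj : Injective _≡_ _≡_ f) →
  InUpsilon k (induce G f f-inj)
upsilon-induce G ups f f-inj m′ g g-inj = ups m′ (f ∘ g) (λ eq → g-inj (f-inj eq))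

perfect-self : (G : Graph n) → Perfect G → IsCliqueNumber G w → IsChromaticNumber G c → w ≡ c
perfect-self G G-perfect = G-perfect _ (λ i → i) (λ eq → eq) _ _

-- The neighbourhood of v in induce G f is an induced subgraph of the (perfect)
-- neighbourhood of f v in G.
neighbourhoodPerfect-induce : (G : Graph n) → NeighborhoodPerfect G →
  (f : Fin m → Fin n) (f-inj : Injective _≡_ _≡_ f) → NeighborhoodPerfect (induce G f f-inj)
neighbourhoodPerfect-induce G G-np f f-inj v m′ g g-inj g-sound _ =
  perfect-≈ (induce-cong G {f-inj = λ eq → position-inj (injective eq)}
                              {g-inj = λ eq → g-inj (f-inj eq)} position-correct)
    (perfect-induce (induce G elem injective) (G-np (f v) size elem injective sound complete)
      position position-inj)
  where
  open Enumeration (enumerate (adj G (f v)))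
  position : Fin m′ → Fin size
  position i = proj₁ (complete (f (g i)) (g-sound i))
  position-correct : ∀ i → elem (position i) ≡ f (g i)
  position-correct i = proj₂ (complete (f (g i)) (g-sound i))
  position-inj : Injective _≡_ _≡_ position
  position-inj {i} {j} eq =
    g-inj (f-inj (trans (≡-sym (position-correct i)) (trans (cong elem eq) (position-correct j))))

rest : Graph (suc q) → Graph q
rest A = induce A suc suc-injective

record Apex (A : Graph (suc q)) : Set where
  constructor mkApex
  field apex-adj : ∀ i → adj A zero (suc i) ≡ true
open Apex

apex-maxDegree : {A : Graph (suc q)} → Apex A → IsMaxDegree A q
apex-maxDegree {q = q} {A = A} apex = deg≤ A , inj₂ (zero , trans (deg≡count A zero) apex-degree)
  where
  apex-degree : count (adj A zero) ≡ q
  apex-degree rewrite irrefl A zero = count-all (adj A zero ∘ suc) (apex-adj apex)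

fresh-colour : {A : Graph (suc q)} → Colorable (rest A) c → Colorable A (suc c)
fresh-colour {A = A} (col , proper) = zero ∷ (suc ∘ col) , proper′
  where
  proper′ : IsProper A (zero ∷ (suc ∘ col))
  proper′ zero    zero    a _  = false≢true (trans (≡-sym (irrefl A zero)) a)
  proper′ zero    (suc j) a ()
  proper′ (suc i) zero    a ()
  proper′ (suc i) (suc j) a eq = proper i j a (suc-injective eq)

-- In an apex graph no other vertex has the colour of zero, so deleting zero and
-- its colour leaves a proper colouring of the rest.
apex-uncolour : {A : Graph (suc q)} → Apex A → Colorable A (suc c) → Colorable (rest A) c
apex-uncolour apex (col , proper) =
  (λ i → punchOut (other i)) ,
  λ i j a eq → proper (suc i) (suc j) a (punchOut-injective (other i) (other j) eq)
  where
  other : ∀ i → col zero ≢ col (suc i)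
  other i = proper zero (suc i) (apex-adj apex i)

apex-chromaticNumber : {A : Graph (suc q)} → Apex A →
  IsChromaticNumber (rest A) c → IsChromaticNumber A (suc c)
apex-chromaticNumber {c = c} {A = A} apex (colouring , minimal) =
  fresh-colour {A = A} colouring , bound
  where
  bound : ∀ k → Colorable A k → suc c ≤ k
  bound zero    (col , _) = ⊥-elim (¬Fin0 (col zero))
  bound (suc k) colouring′ = s≤s (minimal k (apex-uncolour apex colouring′))

apex-clique : {A : Graph (suc q)} → Apex A → HasClique (rest A) s → HasClique A (suc s)
apex-clique {A = A} apex (K , K-inj , K-clique) =
  zero ∷ (suc ∘ K) , ∷-injective (λ eq → K-inj (suc-injective eq)) (λ _ ()) , clique
  where
  clique : ∀ i j → i ≢ j → adj A ((zero ∷ (suc ∘ K)) i) ((zero ∷ (suc ∘ K)) j) ≡ true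
  clique zero    zero    i≢j = ⊥-elim (i≢j refl)
  clique zero    (suc j) _   = apex-adj apex (K j)
  clique (suc i) zero    _   = trans (sym A (suc (K i)) zero) (apex-adj apex (K i))
  clique (suc i) (suc j) i≢j = K-clique i j (i≢j ∘ cong suc)

clique-avoiding-zero : {A : Graph (suc q)} (K : Fin s → Fin (suc q)) → IsClique A K →
  (∀ j → zero ≢ K j) → HasClique (rest A) s
clique-avoiding-zero {A = A} K (K-inj , K-clique) avoids =
  (λ j → punchOut (avoids j)) ,
  (λ eq → K-inj (punchOut-injective (avoids _) (avoids _) eq)) ,
  λ i j i≢j → trans (cong₂ (adj A) (punchIn-punchOut (avoids i)) (punchIn-punchOut (avoids j)))
                    (K-clique i j i≢j)

-- A clique of A loses at most the apex when restricted to the rest.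
apex-cliqueNumber : {A : Graph (suc q)} → Apex A →
  IsCliqueNumber (rest A) w → IsCliqueNumber A (suc w)
apex-cliqueNumber {w = w} {A = A} apex (clique , maximal) = apex-clique apex clique , bound
  where
  bound : ∀ s → HasClique A s → s ≤ suc w
  bound zero    _ = z≤n
  bound (suc s) (K , K-inj , K-clique) with any? (λ i → K i ≟ zero)
  ... | no zero∉K = ≤-trans (maximal (suc s) (clique-avoiding-zero {A = A} K (K-inj , K-clique)
                              λ j eq → zero∉K (j , ≡-sym eq)))
                            (n≤1+n w)
  ... | yes (i , Ki≡zero) = s≤s (maximal s (clique-avoiding-zero {A = A} (K ∘ punchIn i)
          ((λ eq → punchIn-injective i _ _ (K-inj eq)) ,
           λ a b a≢b → K-clique (punchIn i a) (punchIn i b) (a≢b ∘ punchIn-injective i a b))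
          λ j eq → punchInᵢ≢i i j (K-inj (trans (≡-sym eq) (≡-sym Ki≡zero)))))

image? : (e : Fin m → Fin n) → (∃ λ y → ∀ i → e i ≢ y) ⊎ (∀ y → ∃ λ i → e i ≡ y)
image? {n = n} e with all? (λ y → any? (λ i → e i ≟ y))
... | yes onto = inj₂ onto
... | no ¬onto with ¬∀⟶∃¬ n _ (λ y → any? (λ i → e i ≟ y)) ¬onto
...   | y , y∉ = inj₁ (y , λ i eq → y∉ (i , eq))

colorable-onto : {G : Graph n} {e : Fin m → Fin n} {e-inj : Injective _≡_ _≡_ e} →
  (∀ y → ∃ λ i → e i ≡ y) → Colorable (induce G e e-inj) c → Colorable G c
colorable-onto {G = G} onto (col , proper) =
  (λ y → col (preimage y)) ,
  λ y z a → proper (preimage y) (preimage z) (trans (cong₂ (adj G) (correct y) (correct z)) a)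
  where
  preimage = λ y → proj₁ (onto y)
  correct  = λ y → proj₂ (onto y)

colorable-mono : {G : Graph n} → c ≤ k → Colorable G c → Colorable G k
colorable-mono c≤k (col , proper) =
  (λ i → inject≤ (col i) c≤k) , λ i j a eq → proper i j a (inject≤-injective c≤k c≤k _ _ eq)

-- Deleting t vertices lowers the chromatic number by at most t: colour the
-- missing vertices one at a time with fresh colours.
colouring-extension : (G : Graph n) (t : ℕ) (e : Fin m → Fin n) (e-inj : Injective _≡_ _≡_ e) →
  m + t ≡ n → Colorable (induce G e e-inj) c → Colorable G (t + c)
colouring-extension G t e e-inj m+t≡n colouring with image? e
... | inj₂ onto =
  colorable-mono {G = G} (m≤n+m _ t) (colorable-onto {G = G} {e-inj = e-inj} onto colouring)
colouring-extension {m = m} G zero e e-inj m+0≡n colouring | inj₁ (x , x∉) =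
  ⊥-elim (1+n≰n (≤-trans (injective⇒≤ (∷-injective e-inj x∉))
                          (≤-reflexive (trans (≡-sym m+0≡n) (+-identityʳ m)))))
colouring-extension {m = m} {c = c} G (suc t) e e-inj m+t≡n colouring | inj₁ (x , x∉) =
  subst (Colorable G) (+-suc t c)
    (colouring-extension G t (x ∷ e) x∷e-inj (trans (≡-sym (+-suc m t)) m+t≡n)
      (fresh-colour {A = induce G (x ∷ e) x∷e-inj} colouring))
  where x∷e-inj = ∷-injective e-inj x∉

-- Every graph G on n vertices lies in Υ_{n ∸ χ(G)}: an induced subgraph J on
-- m + 1 vertices misses t = n ∸ (m + 1) of them, so χ(G) ≤ t + χ(J), while Δ(J) ≤ m.
upsilon-deficiency : (G : Graph n) → IsChromaticNumber G c → InUpsilon (n ∸ c) G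
upsilon-deficiency {n} {c} G (_ , minimal) m e e-inj d cJ maxDeg (colouringJ , _) = begin
  d + 1        ≡⟨ +-comm d 1 ⟩
  suc d        ≤⟨ s≤s (maxDegree≤ {G = induce G e e-inj} maxDeg) ⟩
  suc m        ≤⟨ +-cancelʳ-≤ t (suc m) (cJ + (n ∸ c)) order+t≤ ⟩
  cJ + (n ∸ c) ∎
  where
  open ≤-Reasoning
  t = proj₁ (m≤n⇒∃[o]m+o≡n (injective⇒≤ e-inj))
  m+t≡n : suc m + t ≡ n
  m+t≡n = proj₂ (m≤n⇒∃[o]m+o≡n (injective⇒≤ e-inj))
  c≤t+cJ : c ≤ t + cJ
  c≤t+cJ = minimal (t + cJ) (colouring-extension G t e e-inj m+t≡n colouringJ)
  order+t≤ : suc m + t ≤ cJ + (n ∸ c) + t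
  order+t≤ = begin
    suc m + t          ≡⟨ m+t≡n ⟩
    n                  ≡⟨ ≡-sym (m+[n∸m]≡n (minimal n (identityColouring G))) ⟩
    c + (n ∸ c)        ≤⟨ +-monoˡ-≤ (n ∸ c) c≤t+cJ ⟩
    t + cJ + (n ∸ c)   ≡⟨ +-assoc t cJ (n ∸ c) ⟩
    t + (cJ + (n ∸ c)) ≡⟨ +-comm t (cJ + (n ∸ c)) ⟩
    cJ + (n ∸ c) + t   ∎

-- Ω_k ⊆ Υ_k for every graph, since ω ≤ χ.
omega⊆upsilon : ∀ k (G : Graph n) → InOmega k G → InUpsilon k G
omega⊆upsilon k G om m e e-inj d c maxDeg (colouring , _) =
  ≤-trans (om m e e-inj d ω maxDeg cω)
          (+-monoˡ-≤ k (clique≤colouring (induce G e e-inj) (proj₁ cω) colouring))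
  where
  ω  = proj₁ (cliqueNumber (induce G e e-inj))
  cω = proj₂ (cliqueNumber (induce G e e-inj))

-- For a vertex v of maximum degree d, the apex graph on v ∪ N(v) has maximum
-- degree d and chromatic number χ(N(v)) + 1 = ω(N(v)) + 1 ≤ ω(J).
neighbourhood-bound : (J : Graph (suc m)) {d : ℕ} → NeighborhoodPerfect J → InUpsilon k J →
  IsMaxDegree J d → IsCliqueNumber J w → d + 1 ≤ w + k
neighbourhood-bound {k = k} {w = w} J _ _ (_ , inj₁ refl) (_ , maximal) =
  ≤-trans (maximal 1 (singleton-clique J)) (m≤m+n w k)
neighbourhood-bound {k = k} {w = w} J {d} J-np ups (_ , inj₂ (v , deg-v)) (_ , maximal) = begin
  d + 1      ≡⟨ cong (_+ 1) (trans (≡-sym deg-v) (trans (deg≡count J v) (≡-sym size≡))) ⟩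
  size + 1   ≤⟨ ups size (v ∷ elem) star-inj size (suc χ₀)
                    (apex-maxDegree star-apex) (apex-chromaticNumber star-apex cχ₀) ⟩
  suc χ₀ + k ≡⟨ cong (λ x → suc x + k) (≡-sym ω₀≡χ₀) ⟩
  suc ω₀ + k ≤⟨ +-monoˡ-≤ k (maximal (suc ω₀) (hasClique-induce {G = J} {f-inj = star-inj}
                    (proj₁ (apex-cliqueNumber star-apex cω₀)))) ⟩
  w + k      ∎
  where
  open ≤-Reasoning
  open Enumeration (enumerate (adj J v))
  N = induce J elem injective
  star-inj : Injective _≡_ _≡_ (v ∷ elem)
  star-inj = ∷-injective injective (λ i → adjacent≢ J (sound i))
  star-apex : Apex (induce J (v ∷ elem) star-inj)
  star-apex = mkApex sound
  ω₀  = proj₁ (cliqueNumber N)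
  cω₀ = proj₂ (cliqueNumber N)
  χ₀  = proj₁ (chromaticNumber N)
  cχ₀ = proj₂ (chromaticNumber N)
  ω₀≡χ₀ : ω₀ ≡ χ₀
  ω₀≡χ₀ = perfect-self N (J-np v size elem injective sound complete) cω₀ cχ₀

upsilon⊆omega : (H : Graph n) → NeighborhoodPerfect H → ∀ k → InUpsilon k H → InOmega k H
upsilon⊆omega H H-np k ups m e e-inj d w maxDeg cw =
  neighbourhood-bound (induce H e e-inj) (neighbourhoodPerfect-induce H H-np e e-inj)
    (upsilon-induce H ups e e-inj) maxDeg cw

-- If the rest of an apex graph A on q + 1 vertices has ω = w < c = χ, then A is
-- in Υ_{q ∸ c} (deficiency bound, χ(A) = c + 1) but not in Ω_{q ∸ c}, as
-- Δ(A) + 1 = q + 1 > (w + 1) + (q ∸ c).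
apex-separates : {A : Graph (suc q)} → Apex A → IsCliqueNumber (rest A) w →
  IsChromaticNumber (rest A) c → w < c → InUpsilon (q ∸ c) A × ¬ InOmega (q ∸ c) A
apex-separates {q = q} {w = w} {c = c} {A = A} apex cw cχ w<c =
  upsilon-deficiency A (apex-chromaticNumber apex cχ) , not-omega
  where
  open ≤-Reasoning
  c≤q : c ≤ q
  c≤q = proj₂ cχ q (identityColouring (rest A))
  not-omega : ¬ InOmega (q ∸ c) A
  not-omega om = 1+n≰n (begin
    suc q           ≡⟨ +-comm 1 q ⟩
    q + 1           ≤⟨ om q (λ i → i) (λ eq → eq) q (suc w)
                          (apex-maxDegree apex) (apex-cliqueNumber apex cw) ⟩
    suc w + (q ∸ c) ≤⟨ +-monoˡ-≤ (q ∸ c) w<c ⟩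
    c + (q ∸ c)     ≡⟨ m+[n∸m]≡n c≤q ⟩
    q               ∎)

-- (2) ⇒ (1): an induced subgraph B of N(v) with ω(B) < χ(B) would make the apex
-- graph on v ∪ B an induced subgraph of G separating Υ_k from Ω_k.
coincidence⇒neighbourhoodPerfect : (G : Graph n) →
  (∀ (k m : ℕ) (f : Fin m → Fin n) (f-inj : Injective _≡_ _≡_ f) →
    InOmega k (induce G f f-inj) ⇔ InUpsilon k (induce G f f-inj)) →
  NeighborhoodPerfect G
coincidence⇒neighbourhoodPerfect G Ω⇔Υ v m f f-inj adjacent _ p g g-inj w c cw cχ with c ≤? w
... | yes c≤w =
  ≤-antisym (clique≤colouring (induce (induce G f f-inj) g g-inj) (proj₁ cw) (proj₁ cχ)) c≤w
... | no  c≰w = ⊥-elim (proj₂ separation (Equivalence.from Ω⇔Υ-star (proj₁ separation)))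
  where
  star-inj : Injective _≡_ _≡_ (v ∷ (f ∘ g))
  star-inj = ∷-injective (λ eq → g-inj (f-inj eq)) (λ i → adjacent≢ G (adjacent (g i)))
  star = induce G (v ∷ (f ∘ g)) star-inj
  Ω⇔Υ-star = Ω⇔Υ (p ∸ c) (suc p) (v ∷ (f ∘ g)) star-inj
  separation : InUpsilon (p ∸ c) star × ¬ InOmega (p ∸ c) star
  separation = apex-separates (mkApex {A = star} (adjacent ∘ g)) cw cχ (≰⇒> c≰w)

theorem8 : ∀ n (G : Graph n) →
    NeighborhoodPerfect G ⇔
    (∀ (k m : ℕ) (f : Fin m → Fin n) (inj : Injective _≡_ _≡_ f) →
      InOmega k (induce G f inj) ⇔ InUpsilon k (induce G f inj))
theorem8 n G = mk⇔
  (λ G-np k m f (f-inj : Injective _≡_ _≡_ f) →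
    mk⇔ (omega⊆upsilon k (induce G f f-inj))
        (upsilon⊆omega (induce G f f-inj) (neighbourhoodPerfect-induce G G-np f f-inj) k))
  (coincidence⇒neighbourhoodPerfect G)
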